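{- For each effect theory term $\hat\Delta\vdash\hat M:\hat A!\Sigma$ and object $X$ of $\mathcal{C}_T$, $\langle\!\langle\hat M\rangle\!\rangle^T_X\circ\langle\Lambda(\lfloor[\![\mathtt{op}]\!]\rfloor_X\circ\pi_2)\rangle_{\mathtt{op}\in\Sigma} = \Lambda(\lfloor[\![\hat M]\!]\rfloor_X\circ\pi_2) : 1\to\big(([\![\hat\Delta]\!]\times([\![\hat A]\!]\Rightarrow_T X))\Rightarrow_T X\big)$.
   Context: Let $T$ be a strong monad on a cartesian category $\mathcal{C}$ with Kleisli exponentials $(Y\Rightarrow_TZ)$ (characterised by $\mathcal{C}_T(J(W\times Y),Z)\cong\mathcal{C}(W,Y\Rightarrow_TZ)$, currying $\Lambda$, evaluation $\mathrm{ev}:(Y\Rightarrow_TZ)\times Y\to TZ$) and distributive Kleisli coproducts. Ground types $\hat A::=b\mid\hat A_1\times\dots\times\hat A_n\mid\hat A_1+\dots+\hat A_n$, interpreted as objects $[\![\hat A]\!]$; ground values $\hat V$ (variables, tuples, projections, injections) interpreted as morphisms. A signature $\Sigma$ is a finite set of entries $\mathtt{op}:\hat A_{\mathtt{op}}\to\hat B_{\mathtt{op}}$ (operation with ground argument and result types; this arrow denotes an operation signature), with given morphisms $[\![\mathtt{op}]\!]:[\![\hat A_{\mathtt{op}}]\!]\to T[\![\hat B_{\mathtt{op}}]\!]$. Effect theory terms $\hat M::=\mathtt{return}\ \hat V\mid\mathtt{let}\ x\Leftarrow\mathtt{op}(\hat V)\ \mathtt{in}\ \hat M\mid\mathtt{case}\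 \hat V\ \mathtt{of}\ \{\iota_ix_i\mapsto\hat M_i\}_{i=1}^n$. Their monadic interpretation $[\![\hat M]\!]:[\![\hat\Delta]\!]\to T[\![\hat A]\!]$: $[\![\mathtt{return}\ \hat V]\!]=\eta\circ[\![\hat V]\!]$; $[\![\mathtt{let}\ x\Leftarrow\mathtt{op}(\hat V)\ \mathtt{in}\ \hat M]\!]=\mu\circ T[\![\hat M]\!]\circ\mathrm{st}\circ\langle\mathrm{id},[\![\mathtt{op}]\!]\circ[\![\hat V]\!]\rangle$; $[\![\mathtt{case}\ \hat V\ \mathtt{of}\ \{\iota_ix_i\mapsto\hat M_i\}]\!]=[[\![\hat M_1]\!],\dots,[\![\hat M_n]\!]]\circ\langle\mathrm{id},[\![\hat V]\!]\rangle$. Let $\mathcal{H}_\Sigma(X)=\prod_{(\mathtt{op}:\hat A_{\mathtt{op}}\to\hat B_{\mathtt{op}})\in\Sigma}(([\![\hat A_{\mathtt{op}}]\!]\times([\![\hat B_{\mathtt{op}}]\!]\Rightarrow_TX))\Rightarrow_TX)$ with projections $\pi_{\mathtt{op}}$. The algebraic interpretation $\langle\!\langle\hat M\rangle\!\rangle^T_X:\mathcal{H}_\Sigma(X)\to(([\![\hat\Delta]\!]\times([\![\hat A]\!]\Rightarrow_TX))\Rightarrow_TX)$ is defined by $\Lambda^{ -1}\langle\!\langle\mathtt{return}\ \hat V\rangle\!\rangle=\mathrm{ev}\circ\mathrm{swap}\circ([\![\hat V]\!]\times\mathrm{id})\circ\pi_2$; $\Lambda^{ -1}\langle\!\langle\mathtt{let}\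 x\Leftarrow\mathtt{op}(\hat V)\ \mathtt{in}\ \hat M\rangle\!\rangle=\mathrm{ev}\circ\langle\pi_{\mathtt{op}}\circ\pi_1,\langle[\![\hat V]\!]\circ\pi_1\circ\pi_2,\Lambda(\Lambda^{ -1}\langle\!\langle\hat M\rangle\!\rangle\circ w)\rangle\rangle$; $\Lambda^{ -1}\langle\!\langle\mathtt{case}\ \hat V\ \mathtt{of}\ \{\iota_ix_i\mapsto\hat M_i\}\rangle\!\rangle=[\Lambda^{ -1}\langle\!\langle\hat M_1\rangle\!\rangle\circ w,\dots,\Lambda^{ -1}\langle\!\langle\hat M_n\rangle\!\rangle\circ w]\circ\langle\mathrm{id},[\![\hat V]\!]\circ\pi_1\circ\pi_2\rangle$, where $w$ is the canonical isomorphism rearranging components (moving the newly bound variable into the context). For $f:A\to TB$ and $X\in\mathcal{C}_T$, $\lfloor f\rfloor_X=\mu\circ T\mathrm{ev}\circ\mathrm{st}\circ\mathrm{swap}\circ(f\times\mathrm{id}):A\times(B\Rightarrow_TX)\to TX$ (the algebraic operation corresponding to the generic effect $f$). -}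

module Defs where

open import Level using (Level; _⊔_) renaming (suc to lsuc)
open import Data.Nat using (ℕ; zero; suc)
open import Data.Fin using (Fin; zero; suc)
open import Relation.Binary using (IsEquivalence)

record Cartesian (o ℓ e : Level) : Set (lsuc (o ⊔ ℓ ⊔ e)) where
  infixr 9 _∘_
  infix 4 _≈_
  infixr 7 _×_
  field
    Obj : Set o
    Hom : Obj → Obj → Set ℓ
    _≈_ : ∀ {A B} → Hom A B → Hom A B → Set e
    ≈-equiv : ∀ {A B} → IsEquivalence (_≈_ {A} {B})
    id : ∀ {A} → Hom A A
    _∘_ : ∀ {A B C} → Hom B C → Hom A B → Hom A C
    ∘-resp-≈ : ∀ {A B C} {f f' : Hom B C} {g g' : Hom A B} →
               f ≈ f' → g ≈ g' → f ∘ g ≈ f' ∘ g'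
    identityˡ : ∀ {A B} {f : Hom A B} → id ∘ f ≈ f
    identityʳ : ∀ {A B} {f : Hom A B} → f ∘ id ≈ f
    assoc : ∀ {A B C D} {f : Hom C D} {g : Hom B C} {h : Hom A B} →
            (f ∘ g) ∘ h ≈ f ∘ (g ∘ h)
    𝟙 : Obj
    ! : ∀ {A} → Hom A 𝟙
    !-unique : ∀ {A} (f : Hom A 𝟙) → f ≈ !
    _×_ : Obj → Obj → Obj
    π₁ : ∀ {A B} → Hom (A × B) A
    π₂ : ∀ {A B} → Hom (A × B) B
    ⟨_,_⟩ : ∀ {A B C} → Hom C A → Hom C B → Hom C (A × B)
    project₁ : ∀ {A B C} {f : Hom C A} {g : Hom C B} → π₁ ∘ ⟨ f , g ⟩ ≈ f
    project₂ : ∀ {A B C} {f : Hom C A} {g : Hom C B} → π₂ ∘ ⟨ f , g ⟩ ≈ g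
    ⟨⟩-unique : ∀ {A B C} {f : Hom C A} {g : Hom C B} {h : Hom C (A × B)} →
                π₁ ∘ h ≈ f → π₂ ∘ h ≈ g → h ≈ ⟨ f , g ⟩

  infixr 8 _⊗_
  _⊗_ : ∀ {A B C D} → Hom A B → Hom C D → Hom (A × C) (B × D)
  f ⊗ g = ⟨ f ∘ π₁ , g ∘ π₂ ⟩

  swap : ∀ {A B} → Hom (A × B) (B × A)
  swap = ⟨ π₂ , π₁ ⟩

  αʳ : ∀ {A B C} → Hom ((A × B) × C) (A × (B × C))
  αʳ = ⟨ π₁ ∘ π₁ , ⟨ π₂ ∘ π₁ , π₂ ⟩ ⟩

  Prod : (n : ℕ) → (Fin n → Obj) → Obj
  Prod zero B = 𝟙
  Prod (suc n) B = B zero × Prod n (λ i → B (suc i))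

  tuple : ∀ {A} n {B : Fin n → Obj} → ((i : Fin n) → Hom A (B i)) → Hom A (Prod n B)
  tuple zero f = !
  tuple (suc n) f = ⟨ f zero , tuple n (λ i → f (suc i)) ⟩

  proj : ∀ n {B : Fin n → Obj} (i : Fin n) → Hom (Prod n B) (B i)
  proj (suc n) zero = π₁
  proj (suc n) (suc i) = proj n i ∘ π₂

record StrongMonad {o ℓ e} (C : Cartesian o ℓ e) : Set (o ⊔ ℓ ⊔ e) where
  open Cartesian C
  field
    T : Obj → Obj
    Tmap : ∀ {A B} → Hom A B → Hom (T A) (T B)
    Tmap-resp-≈ : ∀ {A B} {f g : Hom A B} → f ≈ g → Tmap f ≈ Tmap g
    Tmap-id : ∀ {A} → Tmap (id {A}) ≈ id
    Tmap-∘ : ∀ {A B C} {f : Hom B C} {g : Hom A B} → Tmap (f ∘ g) ≈ Tmap f ∘ Tmap g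
    η : ∀ {A} → Hom A (T A)
    μ : ∀ {A} → Hom (T (T A)) (T A)
    η-natural : ∀ {A B} {f : Hom A B} → Tmap f ∘ η ≈ η ∘ f
    μ-natural : ∀ {A B} {f : Hom A B} → Tmap f ∘ μ ≈ μ ∘ Tmap (Tmap f)
    μ-assoc : ∀ {A} → μ {A} ∘ Tmap μ ≈ μ ∘ μ
    μ-identityˡ : ∀ {A} → μ {A} ∘ Tmap η ≈ id
    μ-identityʳ : ∀ {A} → μ {A} ∘ η ≈ id
    st : ∀ {A B} → Hom (A × T B) (T (A × B))
    st-natural : ∀ {A A' B B'} {f : Hom A A'} {g : Hom B B'} →
                 st ∘ (f ⊗ Tmap g) ≈ Tmap (f ⊗ g) ∘ st
    st-unit : ∀ {A} → Tmap π₂ ∘ st {𝟙} {A} ≈ π₂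
    st-assoc : ∀ {A B C} →
               Tmap αʳ ∘ st {A × B} {C} ≈ st ∘ (id ⊗ st) ∘ αʳ
    st-η : ∀ {A B} → st {A} {B} ∘ (id ⊗ η) ≈ η
    st-μ : ∀ {A B} → st {A} {B} ∘ (id ⊗ μ) ≈ μ ∘ Tmap st ∘ st

-- Kleisli exponentials:  C_T(J(W × Y), Z) ≅ C(W, Y ⇒T Z), natural in W

record KleisliExp {o ℓ e} (C : Cartesian o ℓ e) (M : StrongMonad C) : Set (o ⊔ ℓ ⊔ e) where
  open Cartesian C
  open StrongMonad M
  infixr 6 _⇒T_
  field
    _⇒T_ : Obj → Obj → Obj
    ev : ∀ {Y Z} → Hom ((Y ⇒T Z) × Y) (T Z)
    Λ : ∀ {W Y Z} → Hom (W × Y) (T Z) → Hom W (Y ⇒T Z)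
    Λ-resp-≈ : ∀ {W Y Z} {f g : Hom (W × Y) (T Z)} → f ≈ g → Λ f ≈ Λ g
    exp-β : ∀ {W Y Z} {f : Hom (W × Y) (T Z)} → ev ∘ (Λ f ⊗ id) ≈ f
    exp-η : ∀ {W Y Z} {g : Hom W (Y ⇒T Z)} → Λ (ev ∘ (g ⊗ id)) ≈ g

-- Distributive Kleisli coproducts (n-ary):
--   C_T(A × (B₁+…+Bₙ), C) ≅ Π_i C_T(A × Bᵢ, C)   via precomposition with id ⊗ ιᵢ

record KleisliCoproducts {o ℓ e} (C : Cartesian o ℓ e) (M : StrongMonad C) : Set (o ⊔ ℓ ⊔ e) where
  open Cartesian C
  open StrongMonad M
  field
    ∐ : (n : ℕ) → (Fin n → Obj) → Obj
    ι : ∀ {n} {B : Fin n → Obj} (i : Fin n) → Hom (B i) (∐ n B)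
    [_] : ∀ {A C' n} {B : Fin n → Obj} →
          ((i : Fin n) → Hom (A × B i) (T C')) → Hom (A × ∐ n B) (T C')
    inject : ∀ {A C' n} {B : Fin n → Obj} {f : (i : Fin n) → Hom (A × B i) (T C')}
             (i : Fin n) → [ f ] ∘ (id ⊗ ι i) ≈ f i
    []-unique : ∀ {A C' n} {B : Fin n → Obj} {f : (i : Fin n) → Hom (A × B i) (T C')}
                {g : Hom (A × ∐ n B) (T C')} →
                ((i : Fin n) → g ∘ (id ⊗ ι i) ≈ f i) → g ≈ [ f ]

data GTy (Base : Set) : Set where
  base : Base → GTy Base
  prod : (n : ℕ) → (Fin n → GTy Base) → GTy Base
  sum  : (n : ℕ) → (Fin n → GTy Base) → GTy Base

data Ctx (Base : Set) : Set where
  ε   : Ctx Base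
  _▸_ : Ctx Base → GTy Base → Ctx Base

record Signature (Base : Set) : Set where
  field
    nops : ℕ
    arg  : Fin nops → GTy Base
    res  : Fin nops → GTy Base

module Syntax {Base : Set} (Sig : Signature Base) where
  open Signature Sig

  data Var : Ctx Base → GTy Base → Set where
    vz : ∀ {Δ A} → Var (Δ ▸ A) A
    vs : ∀ {Δ A B} → Var Δ A → Var (Δ ▸ B) A

  data GVal (Δ : Ctx Base) : GTy Base → Set where
    var : ∀ {A} → Var Δ A → GVal Δ A
    tup : ∀ n (As : Fin n → GTy Base) → ((i : Fin n) → GVal Δ (As i)) → GVal Δ (prod n As)
    prj : ∀ n (As : Fin n → GTy Base) (i : Fin n) → GVal Δ (prod n As) → GVal Δ (As i)
    inj : ∀ n (As : Fin n → GTy Base) (i : Fin n) → GVal Δ (As i) → GVal Δ (sum n As)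

  data Term (Δ : Ctx Base) (A : GTy Base) : Set where
    return : GVal Δ A → Term Δ A
    letop  : (o : Fin nops) → GVal Δ (arg o) → Term (Δ ▸ res o) A → Term Δ A
    case   : ∀ n (As : Fin n → GTy Base) → GVal Δ (sum n As) →
             ((j : Fin n) → Term (Δ ▸ As j) A) → Term Δ A

module _ {o ℓ e} (C : Cartesian o ℓ e) (M : StrongMonad C) (D : KleisliCoproducts C M)
         {Base : Set} (⟦b⟧ : Base → Cartesian.Obj C) where
  open Cartesian C
  open KleisliCoproducts D

  ⟦_⟧ᴳ : GTy Base → Obj
  ⟦ base b ⟧ᴳ = ⟦b⟧ b
  ⟦ prod n As ⟧ᴳ = Prod n (λ i → ⟦ As i ⟧ᴳ)
  ⟦ sum n As ⟧ᴳ = ∐ n (λ i → ⟦ As i ⟧ᴳ)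

record Setting (o ℓ e : Level) : Set (lsuc (o ⊔ ℓ ⊔ e)) where
  field
    cat  : Cartesian o ℓ e
    mon  : StrongMonad cat
    kexp : KleisliExp cat mon
    kcop : KleisliCoproducts cat mon
    Base : Set
    ⟦base⟧ : Base → Cartesian.Obj cat
    sig : Signature Base
    ⟦op⟧ : (i : Fin (Signature.nops sig)) →
           Cartesian.Hom cat (⟦_⟧ᴳ cat mon kcop ⟦base⟧ (Signature.arg sig i))
                             (StrongMonad.T mon (⟦_⟧ᴳ cat mon kcop ⟦base⟧ (Signature.res sig i)))

module Interp {o ℓ e} (S : Setting o ℓ e) where
  open Setting S public
  open Cartesian cat public
  open StrongMonad mon public
  open KleisliExp kexp public
  open KleisliCoproducts kcop public
  open Signature sig public
  open Syntax sig public

  ⟦_⟧ : GTy Base → Obj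
  ⟦_⟧ = ⟦_⟧ᴳ cat mon kcop ⟦base⟧

  ⟦_⟧ᶜ : Ctx Base → Obj
  ⟦ ε ⟧ᶜ = 𝟙
  ⟦ Δ ▸ A ⟧ᶜ = ⟦ Δ ⟧ᶜ × ⟦ A ⟧

  ⟦_⟧ᵛᵃʳ : ∀ {Δ A} → Var Δ A → Hom ⟦ Δ ⟧ᶜ ⟦ A ⟧
  ⟦ vz ⟧ᵛᵃʳ = π₂
  ⟦ vs x ⟧ᵛᵃʳ = ⟦ x ⟧ᵛᵃʳ ∘ π₁

  ⟦_⟧ᵛ : ∀ {Δ A} → GVal Δ A → Hom ⟦ Δ ⟧ᶜ ⟦ A ⟧
  ⟦ var x ⟧ᵛ = ⟦ x ⟧ᵛᵃʳ
  ⟦ tup n As Vs ⟧ᵛ = tuple n (λ i → ⟦ Vs i ⟧ᵛ)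
  ⟦ prj n As i v ⟧ᵛ = proj n i ∘ ⟦ v ⟧ᵛ
  ⟦ inj n As i v ⟧ᵛ = ι i ∘ ⟦ v ⟧ᵛ

  ⟦_⟧ᵐ : ∀ {Δ A} → Term Δ A → Hom ⟦ Δ ⟧ᶜ (T ⟦ A ⟧)
  ⟦ return V ⟧ᵐ = η ∘ ⟦ V ⟧ᵛ
  ⟦ letop o V M ⟧ᵐ = μ ∘ Tmap ⟦ M ⟧ᵐ ∘ st ∘ ⟨ id , ⟦op⟧ o ∘ ⟦ V ⟧ᵛ ⟩
  ⟦ case n As V Ms ⟧ᵐ = [ (λ j → ⟦ Ms j ⟧ᵐ) ] ∘ ⟨ id , ⟦ V ⟧ᵛ ⟩

  H : Obj → Obj
  H X = Prod nops (λ o → (⟦ arg o ⟧ × (⟦ res o ⟧ ⇒T X)) ⇒T X)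

  π[_] : ∀ {X} (o : Fin nops) → Hom (H X) ((⟦ arg o ⟧ × (⟦ res o ⟧ ⇒T X)) ⇒T X)
  π[ o ] = proj nops o

  -- canonical rearrangement moving the newly bound variable into the context
  w : ∀ {Hh D K B} → Hom ((Hh × (D × K)) × B) (Hh × ((D × B) × K))
  w = ⟨ π₁ ∘ π₁ , ⟨ ⟨ π₁ ∘ π₂ ∘ π₁ , π₂ ⟩ , π₂ ∘ π₂ ∘ π₁ ⟩ ⟩

  alg : ∀ {Δ A} → Term Δ A → (X : Obj) →
        Hom (H X × (⟦ Δ ⟧ᶜ × (⟦ A ⟧ ⇒T X))) (T X)
  alg (return V) X = ev ∘ swap ∘ (⟦ V ⟧ᵛ ⊗ id) ∘ π₂
  alg (letop o V M) X =
    ev ∘ ⟨ π[ o ] ∘ π₁ , ⟨ ⟦ V ⟧ᵛ ∘ π₁ ∘ π₂ , Λ (alg M X ∘ w) ⟩ ⟩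
  alg (case n As V Ms) X =
    [ (λ j → alg (Ms j) X ∘ w) ] ∘ ⟨ id , ⟦ V ⟧ᵛ ∘ π₁ ∘ π₂ ⟩

  ⟪_⟫ : ∀ {Δ A} → Term Δ A → (X : Obj) →
        Hom (H X) ((⟦ Δ ⟧ᶜ × (⟦ A ⟧ ⇒T X)) ⇒T X)
  ⟪ M ⟫ X = Λ (alg M X)

  ⌊_⌋ : ∀ {A B X} → Hom A (T B) → Hom (A × (B ⇒T X)) (T X)
  ⌊ f ⌋ = μ ∘ Tmap ev ∘ st ∘ swap ∘ (f ⊗ id)

{-# OPTIONS --safe #-}
module Submission where

-- Plugging the generic handlers ⟨ Λ (⌊ ⟦op⟧ ⌋ ∘ π₂) ⟩_op into the algebraic interpretation
-- turns Λ⁻¹ ⟪ M ⟫ into ⌊ ⟦ M ⟧ᵐ ⌋; this is proved by induction on M. Write the monadic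
-- interpretation with the context-passing bind s u (let x ⇐ u in s). Then ⌊ f ⌋ ∘ ⟨ p , q ⟩
-- is bind (ev ∘ (q ⊗ id)) (f ∘ p), so ⌊_⌋ commutes with the three term formers: with
-- return by the unit law, with let by associativity of bind (this is where the strength
-- laws enter), and with case by the universal property of distributive coproducts.

open import Defs
open import Data.Nat using (suc)
open import Data.Fin using (Fin; zero; suc)
open import Relation.Binary using (IsEquivalence; Setoid)
import Relation.Binary.Reasoning.Setoid as SetoidReasoning

module CartesianProperties {o ℓ e} (𝒞 : Cartesian o ℓ e) where
  open Cartesian 𝒞

  private variable
    A B C D E F : Obj

  hom-setoid : ∀ {A B : Obj} → Setoid ℓ e
  hom-setoid {A} {B} = record { Carrier = Hom A B ; _≈_ = _≈_ ; isEquivalence = ≈-equiv }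

  module HomReasoning {A B : Obj} = SetoidReasoning (hom-setoid {A} {B})
  module Equiv {A B : Obj} = IsEquivalence (≈-equiv {A} {B})
  open Equiv public using (refl; sym; trans)

  infixr 4 _⟩∘⟨_ refl⟩∘⟨_
  infixl 5 _⟩∘⟨refl

  _⟩∘⟨_ : ∀ {f f' : Hom B C} {g g' : Hom A B} → f ≈ f' → g ≈ g' → f ∘ g ≈ f' ∘ g'
  _⟩∘⟨_ = ∘-resp-≈

  refl⟩∘⟨_ : ∀ {f : Hom B C} {g g' : Hom A B} → g ≈ g' → f ∘ g ≈ f ∘ g'
  refl⟩∘⟨ p = refl ⟩∘⟨ p

  _⟩∘⟨refl : ∀ {f f' : Hom B C} {g : Hom A B} → f ≈ f' → f ∘ g ≈ f' ∘ g
  p ⟩∘⟨refl = p ⟩∘⟨ refl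

  pullˡ : ∀ {a : Hom C D} {b : Hom B C} {c : Hom B D} {f : Hom A B} →
          a ∘ b ≈ c → a ∘ (b ∘ f) ≈ c ∘ f
  pullˡ p = trans (sym assoc) (p ⟩∘⟨refl)

  pullʳ : ∀ {a : Hom C D} {b : Hom B C} {c : Hom A C} {f : Hom A B} →
          b ∘ f ≈ c → (a ∘ b) ∘ f ≈ a ∘ c
  pullʳ p = trans assoc (refl⟩∘⟨ p)

  ⟨⟩-cong₂ : ∀ {f f' : Hom A B} {g g' : Hom A C} → f ≈ f' → g ≈ g' → ⟨ f , g ⟩ ≈ ⟨ f' , g' ⟩
  ⟨⟩-cong₂ p q = ⟨⟩-unique (trans project₁ p) (trans project₂ q)

  ⊗-cong₂ : ∀ {f f' : Hom A B} {g g' : Hom C D} → f ≈ f' → g ≈ g' → f ⊗ g ≈ f' ⊗ g'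
  ⊗-cong₂ p q = ⟨⟩-cong₂ (p ⟩∘⟨refl) (q ⟩∘⟨refl)

  ⟨⟩∘ : ∀ {f : Hom B C} {g : Hom B D} {h : Hom A B} → ⟨ f , g ⟩ ∘ h ≈ ⟨ f ∘ h , g ∘ h ⟩
  ⟨⟩∘ = ⟨⟩-unique (pullˡ project₁) (pullˡ project₂)

  ⟨π₁,π₂⟩≈id : ⟨ π₁ , π₂ ⟩ ≈ id {A × B}
  ⟨π₁,π₂⟩≈id = sym (⟨⟩-unique identityʳ identityʳ)

  ⊗∘⟨⟩ : ∀ {f : Hom B C} {g : Hom D E} {p : Hom A B} {q : Hom A D} →
         (f ⊗ g) ∘ ⟨ p , q ⟩ ≈ ⟨ f ∘ p , g ∘ q ⟩
  ⊗∘⟨⟩ = trans ⟨⟩∘ (⟨⟩-cong₂ (pullʳ project₁) (pullʳ project₂))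

  ⊗∘⊗ : ∀ {f : Hom B C} {g : Hom E F} {h : Hom A B} {k : Hom D E} →
        (f ⊗ g) ∘ (h ⊗ k) ≈ (f ∘ h) ⊗ (g ∘ k)
  ⊗∘⊗ = trans ⊗∘⟨⟩ (⟨⟩-cong₂ (sym assoc) (sym assoc))

  ⟨⟩≈⊗id∘⟨id,⟩ : ∀ {f : Hom A B} {g : Hom A C} → ⟨ f , g ⟩ ≈ (f ⊗ id) ∘ ⟨ id , g ⟩
  ⟨⟩≈⊗id∘⟨id,⟩ = sym (trans ⊗∘⟨⟩ (⟨⟩-cong₂ identityʳ identityˡ))

  ⟨,∘⟩≈id⊗∘⟨⟩ : ∀ {f : Hom A B} {g : Hom C D} {h : Hom A C} → ⟨ f , g ∘ h ⟩ ≈ (id ⊗ g) ∘ ⟨ f , h ⟩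
  ⟨,∘⟩≈id⊗∘⟨⟩ = sym (trans ⊗∘⟨⟩ (⟨⟩-cong₂ identityˡ refl))

  ⊗id∘id⊗ : ∀ {f : Hom A B} {g : Hom C D} → (f ⊗ id) ∘ (id ⊗ g) ≈ (id ⊗ g) ∘ (f ⊗ id)
  ⊗id∘id⊗ = trans ⊗∘⊗ (trans (⊗-cong₂ (trans identityʳ (sym identityˡ)) (trans identityˡ (sym identityʳ)))
                             (sym ⊗∘⊗))

  swap∘⟨⟩ : ∀ {f : Hom A B} {g : Hom A C} → swap ∘ ⟨ f , g ⟩ ≈ ⟨ g , f ⟩
  swap∘⟨⟩ = trans ⟨⟩∘ (⟨⟩-cong₂ project₂ project₁)

  αʳ∘⟨⟨⟩,⟩ : ∀ {f : Hom A B} {g : Hom A C} {h : Hom A D} → αʳ ∘ ⟨ ⟨ f , g ⟩ , h ⟩ ≈ ⟨ f , ⟨ g , h ⟩ ⟩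
  αʳ∘⟨⟨⟩,⟩ = trans ⟨⟩∘ (⟨⟩-cong₂ (trans (pullʳ project₁) project₁)
                                  (trans ⟨⟩∘ (⟨⟩-cong₂ (trans (pullʳ project₁) project₂) project₂)))

  proj∘tuple : ∀ n {B : Fin n → Obj} (i : Fin n) {f : (i : Fin n) → Hom A (B i)} →
               proj n i ∘ tuple n f ≈ f i
  proj∘tuple (suc n) zero = project₁
  proj∘tuple (suc n) (suc i) = trans (pullʳ project₂) (proj∘tuple n i)

  -- The rearrangement w of the algebraic interpretation, without its handler component.
  shift : Hom ((A × B) × C) ((A × C) × B)
  shift = ⟨ π₁ ⊗ id , π₂ ∘ π₁ ⟩

  shift∘id⊗ : ∀ {g : Hom C D} → shift ∘ (id {A × B} ⊗ g) ≈ ((id ⊗ g) ⊗ id) ∘ shift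
  shift∘id⊗ {g = g} = begin
    shift ∘ (id ⊗ g)
      ≈⟨ ⟨⟩∘ ⟩
    ⟨ (π₁ ⊗ id) ∘ (id ⊗ g) , (π₂ ∘ π₁) ∘ (id ⊗ g) ⟩
      ≈⟨ ⟨⟩-cong₂ (trans ⊗∘⊗ (⊗-cong₂ identityʳ identityˡ)) (pullʳ (trans project₁ identityˡ)) ⟩
    ⟨ π₁ ⊗ g , π₂ ∘ π₁ ⟩
      ≈⟨ ⟨⟩-cong₂ (sym (trans ⊗∘⊗ (⊗-cong₂ identityˡ identityʳ))) (sym identityˡ) ⟩
    ⟨ (id ⊗ g) ∘ (π₁ ⊗ id) , id ∘ π₂ ∘ π₁ ⟩
      ≈⟨ sym ⊗∘⟨⟩ ⟩
    ((id ⊗ g) ⊗ id) ∘ shift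
      ∎
    where open HomReasoning

  shift∘⟨id,∘π₁⟩ : ∀ {v : Hom A C} → shift ∘ ⟨ id {A × B} , v ∘ π₁ ⟩ ≈ ⟨ id , v ⟩ ⊗ id
  shift∘⟨id,∘π₁⟩ {v = v} = begin
    shift ∘ ⟨ id , v ∘ π₁ ⟩
      ≈⟨ ⟨⟩∘ ⟩
    ⟨ (π₁ ⊗ id) ∘ ⟨ id , v ∘ π₁ ⟩ , (π₂ ∘ π₁) ∘ ⟨ id , v ∘ π₁ ⟩ ⟩
      ≈⟨ ⟨⟩-cong₂ (trans ⊗∘⟨⟩ (⟨⟩-cong₂ identityʳ identityˡ)) (trans (pullʳ project₁) identityʳ) ⟩
    ⟨ ⟨ π₁ , v ∘ π₁ ⟩ , π₂ ⟩
      ≈⟨ ⟨⟩-cong₂ (sym (trans ⟨⟩∘ (⟨⟩-cong₂ identityˡ refl))) (sym identityˡ) ⟩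
    ⟨ id , v ⟩ ⊗ id
      ∎
    where open HomReasoning

module StrongMonadProperties {o ℓ e} {𝒞 : Cartesian o ℓ e} (𝕋 : StrongMonad 𝒞) where
  open Cartesian 𝒞
  open StrongMonad 𝕋
  open CartesianProperties 𝒞
  open HomReasoning

  private variable
    A A' B B' C Γ Γ' : Obj

  -- Arranged so that ⟦ letop o V M ⟧ᵐ is definitionally bind ⟦ M ⟧ᵐ (⟦op⟧ o ∘ ⟦ V ⟧ᵛ).
  bind : Hom (Γ × A) (T B) → Hom Γ (T A) → Hom Γ (T B)
  bind s u = μ ∘ Tmap s ∘ st ∘ ⟨ id , u ⟩

  bind-cong : ∀ {s s' : Hom (Γ × A) (T B)} {u u' : Hom Γ (T A)} →
              s ≈ s' → u ≈ u' → bind s u ≈ bind s' u'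
  bind-cong p q = refl⟩∘⟨ Tmap-resp-≈ p ⟩∘⟨ refl⟩∘⟨ ⟨⟩-cong₂ refl q

  Tmap∘Tmap : ∀ {f : Hom B C} {g : Hom A B} {h : Hom Γ (T A)} →
              Tmap f ∘ Tmap g ∘ h ≈ Tmap (f ∘ g) ∘ h
  Tmap∘Tmap = pullˡ (sym Tmap-∘)

  st∘⟨⟩ : ∀ {f : Hom A A'} {g : Hom B B'} {p : Hom Γ A} {u : Hom Γ (T B)} →
          st ∘ ⟨ f ∘ p , Tmap g ∘ u ⟩ ≈ Tmap (f ⊗ g) ∘ st ∘ ⟨ p , u ⟩
  st∘⟨⟩ = trans (refl⟩∘⟨ sym ⊗∘⟨⟩) (trans (pullˡ st-natural) assoc)

  st∘⟨∘,⟩ : ∀ {f : Hom A A'} {p : Hom Γ A} {u : Hom Γ (T B)} →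
            st ∘ ⟨ f ∘ p , u ⟩ ≈ Tmap (f ⊗ id) ∘ st ∘ ⟨ p , u ⟩
  st∘⟨∘,⟩ = trans (refl⟩∘⟨ ⟨⟩-cong₂ refl (sym (trans (Tmap-id ⟩∘⟨refl) identityˡ))) st∘⟨⟩

  st∘⟨,η∘⟩ : ∀ {p : Hom Γ A} {q : Hom Γ B} → st ∘ ⟨ p , η ∘ q ⟩ ≈ η ∘ ⟨ p , q ⟩
  st∘⟨,η∘⟩ = trans (refl⟩∘⟨ ⟨,∘⟩≈id⊗∘⟨⟩) (pullˡ st-η)

  st-st : ∀ {u : Hom Γ (T A)} →
          st ∘ ⟨ id , st ∘ ⟨ id , u ⟩ ⟩ ≈ Tmap ⟨ π₁ , id ⟩ ∘ st ∘ ⟨ id , u ⟩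
  st-st {u = u} = begin
    st ∘ ⟨ id , st ∘ ⟨ id , u ⟩ ⟩
      ≈⟨ refl⟩∘⟨ ⟨,∘⟩≈id⊗∘⟨⟩ ⟩
    st ∘ (id ⊗ st) ∘ ⟨ id , ⟨ id , u ⟩ ⟩
      ≈⟨ refl⟩∘⟨ refl⟩∘⟨ sym αʳ∘⟨⟨⟩,⟩ ⟩
    st ∘ (id ⊗ st) ∘ αʳ ∘ ⟨ ⟨ id , id ⟩ , u ⟩
      ≈⟨ trans (refl⟩∘⟨ sym assoc) (pullˡ (sym st-assoc)) ⟩
    (Tmap αʳ ∘ st) ∘ ⟨ ⟨ id , id ⟩ , u ⟩
      ≈⟨ pullʳ (trans (refl⟩∘⟨ ⟨⟩-cong₂ (sym identityʳ) refl) st∘⟨∘,⟩) ⟩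
    Tmap αʳ ∘ Tmap (⟨ id , id ⟩ ⊗ id) ∘ st ∘ ⟨ id , u ⟩
      ≈⟨ Tmap∘Tmap ⟩
    Tmap (αʳ ∘ (⟨ id , id ⟩ ⊗ id)) ∘ st ∘ ⟨ id , u ⟩
      ≈⟨ Tmap-resp-≈ αʳ∘⟨id,id⟩⊗id ⟩∘⟨refl ⟩
    Tmap ⟨ π₁ , id ⟩ ∘ st ∘ ⟨ id , u ⟩
      ∎
    where
    αʳ∘⟨id,id⟩⊗id : αʳ ∘ (⟨ id , id ⟩ ⊗ id) ≈ ⟨ π₁ , id {_ × A} ⟩
    αʳ∘⟨id,id⟩⊗id = begin
      αʳ ∘ ⟨ ⟨ id , id ⟩ ∘ π₁ , id ∘ π₂ ⟩
        ≈⟨ refl⟩∘⟨ ⟨⟩-cong₂ (trans ⟨⟩∘ (⟨⟩-cong₂ identityˡ identityˡ)) identityˡ ⟩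
      αʳ ∘ ⟨ ⟨ π₁ , π₁ ⟩ , π₂ ⟩
        ≈⟨ αʳ∘⟨⟨⟩,⟩ ⟩
      ⟨ π₁ , ⟨ π₁ , π₂ ⟩ ⟩
        ≈⟨ ⟨⟩-cong₂ refl ⟨π₁,π₂⟩≈id ⟩
      ⟨ π₁ , id ⟩
        ∎

  bind-∘ : ∀ {s : Hom (Γ × A) (T B)} {u : Hom Γ (T A)} {d : Hom Γ' Γ} →
           bind s u ∘ d ≈ bind (s ∘ (d ⊗ id)) (u ∘ d)
  bind-∘ {s = s} {u} {d} = begin
    (μ ∘ Tmap s ∘ st ∘ ⟨ id , u ⟩) ∘ d
      ≈⟨ pullʳ (pullʳ (pullʳ ⟨⟩∘)) ⟩
    μ ∘ Tmap s ∘ st ∘ ⟨ id ∘ d , u ∘ d ⟩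
      ≈⟨ refl⟩∘⟨ refl⟩∘⟨ refl⟩∘⟨ ⟨⟩-cong₂ (trans identityˡ (sym identityʳ)) refl ⟩
    μ ∘ Tmap s ∘ st ∘ ⟨ d ∘ id , u ∘ d ⟩
      ≈⟨ refl⟩∘⟨ refl⟩∘⟨ st∘⟨∘,⟩ ⟩
    μ ∘ Tmap s ∘ Tmap (d ⊗ id) ∘ st ∘ ⟨ id , u ∘ d ⟩
      ≈⟨ refl⟩∘⟨ Tmap∘Tmap ⟩
    bind (s ∘ (d ⊗ id)) (u ∘ d)
      ∎

  st-bind : ∀ {s : Hom (Γ × A) (T B)} {u : Hom Γ (T A)} →
            st ∘ ⟨ id , bind s u ⟩ ≈ bind (st ∘ ⟨ π₁ , s ⟩) u
  st-bind {s = s} {u} = begin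
    st ∘ ⟨ id , μ ∘ Tmap s ∘ st ∘ ⟨ id , u ⟩ ⟩
      ≈⟨ refl⟩∘⟨ ⟨,∘⟩≈id⊗∘⟨⟩ ⟩
    st ∘ (id ⊗ μ) ∘ ⟨ id , Tmap s ∘ st ∘ ⟨ id , u ⟩ ⟩
      ≈⟨ trans (pullˡ st-μ) (pullʳ assoc) ⟩
    μ ∘ Tmap st ∘ st ∘ ⟨ id , Tmap s ∘ st ∘ ⟨ id , u ⟩ ⟩
      ≈⟨ refl⟩∘⟨ refl⟩∘⟨ trans (refl⟩∘⟨ ⟨⟩-cong₂ (sym identityˡ) refl) st∘⟨⟩ ⟩
    μ ∘ Tmap st ∘ Tmap (id ⊗ s) ∘ st ∘ ⟨ id , st ∘ ⟨ id , u ⟩ ⟩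
      ≈⟨ refl⟩∘⟨ refl⟩∘⟨ refl⟩∘⟨ st-st ⟩
    μ ∘ Tmap st ∘ Tmap (id ⊗ s) ∘ Tmap ⟨ π₁ , id ⟩ ∘ st ∘ ⟨ id , u ⟩
      ≈⟨ refl⟩∘⟨ trans (refl⟩∘⟨ Tmap∘Tmap) Tmap∘Tmap ⟩
    μ ∘ Tmap (st ∘ (id ⊗ s) ∘ ⟨ π₁ , id ⟩) ∘ st ∘ ⟨ id , u ⟩
      ≈⟨ refl⟩∘⟨ Tmap-resp-≈ (refl⟩∘⟨ trans ⊗∘⟨⟩ (⟨⟩-cong₂ identityˡ identityʳ)) ⟩∘⟨refl ⟩
    bind (st ∘ ⟨ π₁ , s ⟩) u
      ∎

  μ∘Tmap∘bind : ∀ {t : Hom B (T C)} {s : Hom (Γ × A) (T B)} {u : Hom Γ (T A)} →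
                μ ∘ Tmap t ∘ bind s u ≈ bind (μ ∘ Tmap t ∘ s) u
  μ∘Tmap∘bind {t = t} {s} {u} = begin
    μ ∘ Tmap t ∘ μ ∘ Tmap s ∘ st ∘ ⟨ id , u ⟩
      ≈⟨ refl⟩∘⟨ pullˡ μ-natural ⟩
    μ ∘ (μ ∘ Tmap (Tmap t)) ∘ Tmap s ∘ st ∘ ⟨ id , u ⟩
      ≈⟨ trans (pullˡ (pullˡ (sym μ-assoc))) (trans assoc assoc) ⟩
    μ ∘ Tmap μ ∘ Tmap (Tmap t) ∘ Tmap s ∘ st ∘ ⟨ id , u ⟩
      ≈⟨ refl⟩∘⟨ trans (refl⟩∘⟨ Tmap∘Tmap) Tmap∘Tmap ⟩
    bind (μ ∘ Tmap t ∘ s) u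
      ∎

  bind-assoc : ∀ {t : Hom (Γ × B) (T C)} {s : Hom (Γ × A) (T B)} {u : Hom Γ (T A)} →
               bind t (bind s u) ≈ bind (bind (t ∘ (π₁ ⊗ id)) s) u
  bind-assoc {t = t} {s} {u} = begin
    μ ∘ Tmap t ∘ st ∘ ⟨ id , bind s u ⟩
      ≈⟨ refl⟩∘⟨ refl⟩∘⟨ st-bind ⟩
    μ ∘ Tmap t ∘ bind (st ∘ ⟨ π₁ , s ⟩) u
      ≈⟨ μ∘Tmap∘bind ⟩
    bind (μ ∘ Tmap t ∘ st ∘ ⟨ π₁ , s ⟩) u
      ≈⟨ bind-cong (refl⟩∘⟨ refl⟩∘⟨ trans (refl⟩∘⟨ ⟨⟩-cong₂ (sym identityʳ) refl) st∘⟨∘,⟩) refl ⟩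
    bind (μ ∘ Tmap t ∘ Tmap (π₁ ⊗ id) ∘ st ∘ ⟨ id , s ⟩) u
      ≈⟨ bind-cong (refl⟩∘⟨ Tmap∘Tmap) refl ⟩
    bind (bind (t ∘ (π₁ ⊗ id)) s) u
      ∎

module KleisliExpProperties {o ℓ e} {𝒞 : Cartesian o ℓ e} {𝕋 : StrongMonad 𝒞}
                            (𝔼 : KleisliExp 𝒞 𝕋) where
  open Cartesian 𝒞
  open StrongMonad 𝕋 using (T)
  open KleisliExp 𝔼
  open CartesianProperties 𝒞
  open HomReasoning

  private variable
    A B C D : Obj

  ev∘⟨Λ∘,⟩ : ∀ {f : Hom (B × C) (T D)} {p : Hom A B} {q : Hom A C} →
             ev ∘ ⟨ Λ f ∘ p , q ⟩ ≈ f ∘ ⟨ p , q ⟩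
  ev∘⟨Λ∘,⟩ {f = f} {p} {q} = begin
    ev ∘ ⟨ Λ f ∘ p , q ⟩          ≈⟨ refl⟩∘⟨ sym (trans ⊗∘⟨⟩ (⟨⟩-cong₂ refl identityˡ)) ⟩
    ev ∘ (Λ f ⊗ id) ∘ ⟨ p , q ⟩   ≈⟨ pullˡ exp-β ⟩
    f ∘ ⟨ p , q ⟩                 ∎

  Λ∘ : ∀ {f : Hom (B × C) (T D)} {g : Hom A B} → Λ f ∘ g ≈ Λ (f ∘ (g ⊗ id))
  Λ∘ {f = f} {g} = begin
    Λ f ∘ g                     ≈⟨ sym exp-η ⟩
    Λ (ev ∘ ((Λ f ∘ g) ⊗ id))   ≈⟨ Λ-resp-≈ (trans (refl⟩∘⟨ ⟨⟩-cong₂ assoc refl) ev∘⟨Λ∘,⟩) ⟩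
    Λ (f ∘ (g ⊗ id))            ∎

module KleisliCoproductProperties {o ℓ e} {𝒞 : Cartesian o ℓ e} {𝕋 : StrongMonad 𝒞}
                                  (𝔻 : KleisliCoproducts 𝒞 𝕋) where
  open Cartesian 𝒞
  open StrongMonad 𝕋 using (T)
  open KleisliCoproducts 𝔻
  open CartesianProperties 𝒞

  private variable
    A A' C : Obj

  []-cong : ∀ {n} {B : Fin n → Obj} {f g : (i : Fin n) → Hom (A × B i) (T C)} →
            (∀ i → f i ≈ g i) → [ f ] ≈ [ g ]
  []-cong p = []-unique (λ i → trans (inject i) (p i))

  []∘⊗id : ∀ {n} {B : Fin n → Obj} {f : (i : Fin n) → Hom (A × B i) (T C)} {g : Hom A' A} →
           [ f ] ∘ (g ⊗ id) ≈ [ (λ i → f i ∘ (g ⊗ id)) ]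
  []∘⊗id = []-unique (λ i → trans (pullʳ ⊗id∘id⊗) (pullˡ (inject i)))

module AlgebraicOperations {o ℓ e} (S : Setting o ℓ e) where
  open Interp S
  open CartesianProperties cat
  open StrongMonadProperties mon
  open HomReasoning

  private variable
    A B C Γ X : Obj

  ⌊⌋-cong : ∀ {f g : Hom A (T B)} → f ≈ g → ⌊_⌋ {X = X} f ≈ ⌊ g ⌋
  ⌊⌋-cong p = refl⟩∘⟨ refl⟩∘⟨ refl⟩∘⟨ refl⟩∘⟨ ⊗-cong₂ p refl

  ⌊∘⌋ : ∀ {f : Hom B (T C)} {g : Hom A B} → ⌊ f ∘ g ⌋ ≈ ⌊ f ⌋ ∘ (g ⊗ id {C ⇒T X})
  ⌊∘⌋ = sym (pullʳ (pullʳ (pullʳ (pullʳ (trans ⊗∘⊗ (⊗-cong₂ refl identityˡ))))))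

  ⌊⌋∘⟨⟩ : ∀ {f : Hom A (T B)} {p : Hom Γ A} {q : Hom Γ (B ⇒T X)} →
          ⌊ f ⌋ ∘ ⟨ p , q ⟩ ≈ bind (ev ∘ (q ⊗ id)) (f ∘ p)
  ⌊⌋∘⟨⟩ {f = f} {p} {q} = begin
    (μ ∘ Tmap ev ∘ st ∘ swap ∘ (f ⊗ id)) ∘ ⟨ p , q ⟩
      ≈⟨ pullʳ (pullʳ (pullʳ (pullʳ ⊗∘⟨⟩))) ⟩
    μ ∘ Tmap ev ∘ st ∘ swap ∘ ⟨ f ∘ p , id ∘ q ⟩
      ≈⟨ refl⟩∘⟨ refl⟩∘⟨ refl⟩∘⟨ trans swap∘⟨⟩ (⟨⟩-cong₂ (trans identityˡ (sym identityʳ)) refl) ⟩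
    μ ∘ Tmap ev ∘ st ∘ ⟨ q ∘ id , f ∘ p ⟩
      ≈⟨ refl⟩∘⟨ refl⟩∘⟨ st∘⟨∘,⟩ ⟩
    μ ∘ Tmap ev ∘ Tmap (q ⊗ id) ∘ st ∘ ⟨ id , f ∘ p ⟩
      ≈⟨ refl⟩∘⟨ Tmap∘Tmap ⟩
    bind (ev ∘ (q ⊗ id)) (f ∘ p)
      ∎

  ⌊η∘⌋ : ∀ {f : Hom A B} → ⌊ η ∘ f ⌋ ≈ ev ∘ swap ∘ (f ⊗ id {B ⇒T X})
  ⌊η∘⌋ {f = f} = begin
    μ ∘ Tmap ev ∘ st ∘ swap ∘ ((η ∘ f) ⊗ id)
      ≈⟨ refl⟩∘⟨ refl⟩∘⟨ refl⟩∘⟨ trans swap∘⟨⟩ (⟨⟩-cong₂ refl assoc) ⟩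
    μ ∘ Tmap ev ∘ st ∘ ⟨ id ∘ π₂ , η ∘ f ∘ π₁ ⟩
      ≈⟨ refl⟩∘⟨ refl⟩∘⟨ st∘⟨,η∘⟩ ⟩
    μ ∘ Tmap ev ∘ η ∘ ⟨ id ∘ π₂ , f ∘ π₁ ⟩
      ≈⟨ refl⟩∘⟨ pullˡ η-natural ⟩
    μ ∘ (η ∘ ev) ∘ ⟨ id ∘ π₂ , f ∘ π₁ ⟩
      ≈⟨ pullˡ (trans (pullˡ μ-identityʳ) identityˡ) ⟩
    ev ∘ ⟨ id ∘ π₂ , f ∘ π₁ ⟩
      ≈⟨ refl⟩∘⟨ sym swap∘⟨⟩ ⟩
    ev ∘ swap ∘ (f ⊗ id)
      ∎

  ⌊bind⌋ : ∀ {m : Hom (A × B) (T C)} {u : Hom A (T B)} →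
           ⌊ bind m u ⌋ ≈ bind (⌊_⌋ {X = X} m ∘ shift) (u ∘ π₁)
  ⌊bind⌋ {m = m} {u} = begin
    ⌊ bind m u ⌋
      ≈⟨ sym (trans (refl⟩∘⟨ ⟨π₁,π₂⟩≈id) identityʳ) ⟩
    ⌊ bind m u ⌋ ∘ ⟨ π₁ , π₂ ⟩
      ≈⟨ trans ⌊⌋∘⟨⟩ (bind-cong refl bind-∘) ⟩
    bind (ev ∘ (π₂ ⊗ id)) (bind (m ∘ (π₁ ⊗ id)) (u ∘ π₁))
      ≈⟨ bind-assoc ⟩
    bind (bind ((ev ∘ (π₂ ⊗ id)) ∘ (π₁ ⊗ id)) (m ∘ (π₁ ⊗ id))) (u ∘ π₁)
      ≈⟨ bind-cong (bind-cong (pullʳ (trans ⊗∘⊗ (⊗-cong₂ refl identityˡ))) refl) refl ⟩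
    bind (bind (ev ∘ ((π₂ ∘ π₁) ⊗ id)) (m ∘ (π₁ ⊗ id))) (u ∘ π₁)
      ≈⟨ bind-cong (sym ⌊⌋∘⟨⟩) refl ⟩
    bind (⌊ m ⌋ ∘ shift) (u ∘ π₁)
      ∎

  ⌊[]⌋∘shift : ∀ {n} {Bs : Fin n → Obj} {ms : (i : Fin n) → Hom (A × Bs i) (T C)} →
               ⌊_⌋ {X = X} [ ms ] ∘ shift ≈ [ (λ i → ⌊ ms i ⌋ ∘ shift) ]
  ⌊[]⌋∘shift {ms = ms} = []-unique λ i → begin
    (⌊ [ ms ] ⌋ ∘ shift) ∘ (id ⊗ ι i)        ≈⟨ pullʳ shift∘id⊗ ⟩
    ⌊ [ ms ] ⌋ ∘ ((id ⊗ ι i) ⊗ id) ∘ shift   ≈⟨ pullˡ (sym ⌊∘⌋) ⟩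
    ⌊ [ ms ] ∘ (id ⊗ ι i) ⌋ ∘ shift          ≈⟨ ⌊⌋-cong (inject i) ⟩∘⟨refl ⟩
    ⌊ ms i ⌋ ∘ shift                         ∎

  ⌊[]∘⟨id,⟩⌋ : ∀ {n} {Bs : Fin n → Obj} {ms : (i : Fin n) → Hom (A × Bs i) (T C)}
               {v : Hom A (∐ n Bs)} →
               ⌊ [ ms ] ∘ ⟨ id , v ⟩ ⌋ ≈ [ (λ i → ⌊_⌋ {X = X} (ms i) ∘ shift) ] ∘ ⟨ id , v ∘ π₁ ⟩
  ⌊[]∘⟨id,⟩⌋ {ms = ms} {v} = begin
    ⌊ [ ms ] ∘ ⟨ id , v ⟩ ⌋                          ≈⟨ ⌊∘⌋ ⟩
    ⌊ [ ms ] ⌋ ∘ (⟨ id , v ⟩ ⊗ id)                   ≈⟨ refl⟩∘⟨ sym shift∘⟨id,∘π₁⟩ ⟩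
    ⌊ [ ms ] ⌋ ∘ shift ∘ ⟨ id , v ∘ π₁ ⟩             ≈⟨ pullˡ ⌊[]⌋∘shift ⟩
    [ (λ i → ⌊ ms i ⌋ ∘ shift) ] ∘ ⟨ id , v ∘ π₁ ⟩   ∎

module GenericHandlers {o ℓ e} (S : Setting o ℓ e) (X : Cartesian.Obj (Setting.cat S)) where
  open Interp S
  open CartesianProperties cat
  open StrongMonadProperties mon
  open KleisliExpProperties kexp
  open KleisliCoproductProperties kcop
  open AlgebraicOperations S
  open HomReasoning

  private variable
    B D K Γ : Obj

  generic-handlers : Hom 𝟙 (H X)
  generic-handlers = tuple nops (λ op → Λ (⌊ ⟦op⟧ op ⌋ ∘ π₂ {𝟙}))

  with-handlers : Hom Γ (H X × Γ)
  with-handlers = ⟨ generic-handlers ∘ ! , id ⟩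

  generic-handlers⊗id : generic-handlers ⊗ id {Γ} ≈ with-handlers ∘ π₂
  generic-handlers⊗id = begin
    ⟨ generic-handlers ∘ π₁ , id ∘ π₂ ⟩
      ≈⟨ ⟨⟩-cong₂ (refl⟩∘⟨ !-unique π₁) refl ⟩
    ⟨ generic-handlers ∘ ! , id ∘ π₂ ⟩
      ≈⟨ ⟨⟩-cong₂ (sym (pullʳ (!-unique _))) refl ⟩
    ⟨ (generic-handlers ∘ !) ∘ π₂ , id ∘ π₂ ⟩
      ≈⟨ sym ⟨⟩∘ ⟩
    with-handlers ∘ π₂
      ∎

  w∘with-handlers⊗id : w ∘ (with-handlers ⊗ id {B}) ≈ with-handlers {(D × B) × K} ∘ shift
  w∘with-handlers⊗id = begin
    w ∘ (with-handlers ⊗ id)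
      ≈⟨ trans ⟨⟩∘ (⟨⟩-cong₂ handlers (trans ⟨⟩∘ (⟨⟩-cong₂ (trans ⟨⟩∘ (⟨⟩-cong₂ (context π₁) bound))
                                                          (context π₂)))) ⟩
    ⟨ generic-handlers ∘ ! , ⟨ ⟨ π₁ ∘ π₁ , π₂ ⟩ , π₂ ∘ π₁ ⟩ ⟩
      ≈⟨ ⟨⟩-cong₂ (sym (pullʳ (!-unique _))) (⟨⟩-cong₂ (⟨⟩-cong₂ refl (sym identityˡ)) refl) ⟩
    ⟨ (generic-handlers ∘ !) ∘ shift , shift ⟩
      ≈⟨ sym (trans ⟨⟩∘ (⟨⟩-cong₂ refl identityˡ)) ⟩
    with-handlers ∘ shift
      ∎
    where
    handlers : (π₁ ∘ π₁) ∘ (with-handlers ⊗ id {B}) ≈ generic-handlers ∘ !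
    handlers = trans (pullʳ project₁) (trans (pullˡ project₁) (pullʳ (!-unique _)))
    context : ∀ {E} (x : Hom (D × K) E) → (x ∘ π₂ ∘ π₁) ∘ (with-handlers ⊗ id {B}) ≈ x ∘ π₁
    context x = trans (pullʳ (pullʳ project₁)) (refl⟩∘⟨ trans (pullˡ project₂) identityˡ)
    bound : π₂ ∘ (with-handlers {D × K} ⊗ id {B}) ≈ π₂
    bound = trans project₂ identityˡ

  ∘w∘with-handlers⊗id : ∀ {f : Hom (H X × ((D × B) × K)) (T X)} {g : Hom ((D × B) × K) (T X)} →
                        f ∘ with-handlers ≈ g → (f ∘ w) ∘ (with-handlers ⊗ id) ≈ g ∘ shift
  ∘w∘with-handlers⊗id p = trans (pullʳ w∘with-handlers⊗id) (pullˡ p)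

  value∘with-handlers : ∀ {A} {v : Hom D A} → (v ∘ π₁ ∘ π₂) ∘ with-handlers {D × K} ≈ v ∘ π₁
  value∘with-handlers = pullʳ (trans (pullʳ project₂) identityʳ)

  alg∘with-handlers : ∀ {Δ A} (M : Term Δ A) → alg M X ∘ with-handlers ≈ ⌊ ⟦ M ⟧ᵐ ⌋
  alg∘with-handlers (return V) = begin
    (ev ∘ swap ∘ (⟦ V ⟧ᵛ ⊗ id) ∘ π₂) ∘ with-handlers   ≈⟨ pullʳ (pullʳ (trans (pullʳ project₂) identityʳ)) ⟩
    ev ∘ swap ∘ (⟦ V ⟧ᵛ ⊗ id)                          ≈⟨ sym ⌊η∘⌋ ⟩
    ⌊ η ∘ ⟦ V ⟧ᵛ ⌋                                     ∎
  alg∘with-handlers (letop o V M) = begin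
    (ev ∘ ⟨ π[ o ] ∘ π₁ , ⟨ ⟦ V ⟧ᵛ ∘ π₁ ∘ π₂ , Λ (alg M X ∘ w) ⟩ ⟩) ∘ with-handlers
      ≈⟨ pullʳ (trans ⟨⟩∘ (⟨⟩-cong₂ operation (trans ⟨⟩∘ (⟨⟩-cong₂ value∘with-handlers continuation)))) ⟩
    ev ∘ ⟨ Λ (⌊ ⟦op⟧ o ⌋ ∘ π₂) ∘ ! , ⟨ ⟦ V ⟧ᵛ ∘ π₁ , Λ (⌊ ⟦ M ⟧ᵐ ⌋ ∘ shift) ⟩ ⟩
      ≈⟨ trans ev∘⟨Λ∘,⟩ (pullʳ project₂) ⟩
    ⌊ ⟦op⟧ o ⌋ ∘ ⟨ ⟦ V ⟧ᵛ ∘ π₁ , Λ (⌊ ⟦ M ⟧ᵐ ⌋ ∘ shift) ⟩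
      ≈⟨ ⌊⌋∘⟨⟩ ⟩
    bind (ev ∘ (Λ (⌊ ⟦ M ⟧ᵐ ⌋ ∘ shift) ⊗ id)) (⟦op⟧ o ∘ ⟦ V ⟧ᵛ ∘ π₁)
      ≈⟨ bind-cong exp-β (sym assoc) ⟩
    bind (⌊ ⟦ M ⟧ᵐ ⌋ ∘ shift) ((⟦op⟧ o ∘ ⟦ V ⟧ᵛ) ∘ π₁)
      ≈⟨ sym ⌊bind⌋ ⟩
    ⌊ ⟦ letop o V M ⟧ᵐ ⌋
      ∎
    where
    operation : (π[ o ] ∘ π₁) ∘ with-handlers ≈ Λ (⌊ ⟦op⟧ o ⌋ ∘ π₂) ∘ !
    operation = trans (pullʳ project₁) (pullˡ (proj∘tuple nops o))
    continuation : Λ (alg M X ∘ w) ∘ with-handlers ≈ Λ (⌊ ⟦ M ⟧ᵐ ⌋ ∘ shift)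
    continuation = trans Λ∘ (Λ-resp-≈ (∘w∘with-handlers⊗id (alg∘with-handlers M)))
  alg∘with-handlers (case n As V Ms) = begin
    ([ (λ j → alg (Ms j) X ∘ w) ] ∘ ⟨ id , ⟦ V ⟧ᵛ ∘ π₁ ∘ π₂ ⟩) ∘ with-handlers
      ≈⟨ pullʳ (trans ⟨⟩∘ (⟨⟩-cong₂ identityˡ value∘with-handlers)) ⟩
    [ (λ j → alg (Ms j) X ∘ w) ] ∘ ⟨ with-handlers , ⟦ V ⟧ᵛ ∘ π₁ ⟩
      ≈⟨ refl⟩∘⟨ ⟨⟩≈⊗id∘⟨id,⟩ ⟩
    [ (λ j → alg (Ms j) X ∘ w) ] ∘ (with-handlers ⊗ id) ∘ ⟨ id , ⟦ V ⟧ᵛ ∘ π₁ ⟩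
      ≈⟨ pullˡ []∘⊗id ⟩
    [ (λ j → (alg (Ms j) X ∘ w) ∘ (with-handlers ⊗ id)) ] ∘ ⟨ id , ⟦ V ⟧ᵛ ∘ π₁ ⟩
      ≈⟨ []-cong (λ j → ∘w∘with-handlers⊗id (alg∘with-handlers (Ms j))) ⟩∘⟨refl ⟩
    [ (λ j → ⌊ ⟦ Ms j ⟧ᵐ ⌋ ∘ shift) ] ∘ ⟨ id , ⟦ V ⟧ᵛ ∘ π₁ ⟩
      ≈⟨ sym ⌊[]∘⟨id,⟩⌋ ⟩
    ⌊ ⟦ case n As V Ms ⟧ᵐ ⌋
      ∎

lemma6p5 : ∀ {o ℓ e} (S : Setting o ℓ e) → let open Interp S in
    ∀ {Δ A} (M : Term Δ A) (X : Obj) →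
      ⟪ M ⟫ X ∘ tuple nops (λ op → Λ (⌊ ⟦op⟧ op ⌋ ∘ π₂ {𝟙}))
        ≈ Λ (⌊ ⟦ M ⟧ᵐ ⌋ ∘ π₂ {𝟙})
lemma6p5 S M X = begin
  ⟪ M ⟫ X ∘ generic-handlers              ≈⟨ Λ∘ ⟩
  Λ (alg M X ∘ (generic-handlers ⊗ id))   ≈⟨ Λ-resp-≈ (refl⟩∘⟨ generic-handlers⊗id) ⟩
  Λ (alg M X ∘ with-handlers ∘ π₂)        ≈⟨ Λ-resp-≈ (pullˡ (alg∘with-handlers M)) ⟩
  Λ (⌊ ⟦ M ⟧ᵐ ⌋ ∘ π₂)                     ∎
  where
  open Interp S
  open CartesianProperties cat
  open KleisliExpProperties kexp
  open GenericHandlers S X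
  open HomReasoning
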